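{- Let $P=(I,J,K)$ be a reduced presentation, let $\mathbf B_\Delta$ be the algebra associated with $P$ as defined below, and let $a\in I$. Then $\mathbf{Ł}_a$ is embeddable in $\mathbf B_\Delta$.
   Context: A Wajsberg hoop is a commutative integral residuated lattice $\langle A,\vee,\wedge,\cdot,\rightarrow,1\rangle$ satisfying $(x\rightarrow y)\vee(y\rightarrow x)\approx1$, $x(x\rightarrow y)\approx y(y\rightarrow x)$ and $(x\rightarrow y)\rightarrow y\approx(y\rightarrow x)\rightarrow x$. For a totally ordered abelian group $\mathbf G$ with strong unit $u>0$, $\Gamma(\mathbf G,u)$ is the Wajsberg hoop on $\{a\in G:0\le a\le u\}$ with $a\cdot b=\max\{a+b-u,0\}$, $a\rightarrow b=\min\{u-a+b,u\}$, top $u$; in it $\neg a:=a\rightarrow 0$. $\mathbb Z\times_l\mathbb Z$ is the lexicographic product of two copies of $\mathbb Z$ (first coordinate dominant). $\mathbf{Ł}_n=\Gamma(\mathbb Z,n)$ (universe $\{0,\dots,n\}$), $\mathbf{Ł}_{n,k}=\Gamma(\mathbb Z\times_l\mathbb Z,(n,k))$; $\mathbf C_\omega$ is the negative cone of $\mathbb Z$ ($\{0,-1,\dots\}$, product $=$ addition, $a\rightarrow b=\min\{0,b-a\}$) with generator $c=-1$. A reduced presentation is a triple $P=(I,J,K)$ with $I,J$ finite sets of positive integers and $K\subseteq\{\omega\}$ such that $I\cup J\cup K\neq\emptyset$; if $J\ne\emptyset$ then $K=\emptyset$; no $m\in I$ divides any element of $(I\setminus\{m\})\cup J$; no $n\in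 J$ divides any element of $J\setminus\{n\}$. $X{\downarrow}$ denotes the set of divisors of elements of a finite set $X$ of positive integers. For $k\ge2$, $0<h<k$ relatively prime, $g_{k,h}$ is the unique generator $g$ of $\mathbf{Ł}_{k,h}$ with $g\le\neg g$; $g_{1,0}=(0,1)\in\mathbf{Ł}_{1,0}$. Let $\Delta_I=\{(k,h,2):0\le h<k\in I{\downarrow},\ \gcd(k,h)=1\}$, $\Delta_J=\{(k,h,i):i\in\{0,1\},\ 0\le h<k\in J{\downarrow},\ \gcd(k,h)=1\}$, $\Delta_K=\{(0,0,3)\}$ if $K\ne\emptyset$ and $\emptyset$ otherwise, $\Delta=\Delta_I\cup\Delta_J\cup\Delta_K$; $\mathbf A_\Delta=\prod_{(k,h,i)\in\Delta}\mathbf A^i_{k,h}$ where $\mathbf A^0_{k,h}=\mathbf A^1_{k,h}=\mathbf{Ł}_{k,h}$, $\mathbf A^2_{k,h}=\mathbf{Ł}_k$, $\mathbf A^3_{k,h}=\mathbf C_\omega$. Let $\bar g\in A_\Delta$ be given by $\bar g(k,h,2)=h$, $\bar g(0,0,3)=c$, $\bar g(k,h,0)=g_{k,h}$, $\bar g(k,h,1)=\neg g_{k,h}$, and let $\mathbf B_\Delta$ be the subalgebra of $\mathbf A_\Delta$ generated by $\bar g$. -}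

module Defs where

open import Data.Bool using (Bool; true; false; _∧_; _∨_; if_then_else_; T)
open import Data.Nat as ℕ using (ℕ; zero; suc; _<ᵇ_; _≡ᵇ_)
open import Data.Nat.Divisibility using (_∣_; _∣?_)
open import Data.Nat.GCD using (gcd)
open import Data.Integer as ℤ using (ℤ; +_; -[1+_])
open import Data.List using (List; [])
open import Data.Bool.ListAction using (any)
open import Data.List.Membership.Propositional using (_∈_)
open import Data.Product using (Σ; _×_; _,_; proj₁; proj₂)
open import Data.Sum using (_⊎_)
open import Relation.Nullary using (¬_)
open import Relation.Nullary.Decidable using (⌊_⌋)
open import Relation.Binary.PropositionalEquality using (_≡_; _≢_)

-- Algebras in the signature of Wajsberg hoops  ⟨A, ∨, ∧, ·, →, 1⟩.
-- Carrier is an ambient type; U carves out the actual universe.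
-- Operations on elements outside U are irrelevant.

record Alg : Set₁ where
  field
    Carrier : Set
    _≈_     : Carrier → Carrier → Set
    U       : Carrier → Set
    _∨ₐ_ _∧ₐ_ _·ₐ_ _⇒ₐ_ : Carrier → Carrier → Carrier
    𝟙       : Carrier

open Alg public

data Term : Set where
  var  : Term
  one  : Term
  _∨ᵗ_ _∧ᵗ_ _·ᵗ_ _⇒ᵗ_ : Term → Term → Term

eval : (A : Alg) → Carrier A → Term → Carrier A
eval A g var       = g
eval A g one       = 𝟙 A
eval A g (s ∨ᵗ t)  = _∨ₐ_ A (eval A g s) (eval A g t)
eval A g (s ∧ᵗ t)  = _∧ₐ_ A (eval A g s) (eval A g t)
eval A g (s ·ᵗ t)  = _·ₐ_ A (eval A g s) (eval A g t)
eval A g (s ⇒ᵗ t)  = _⇒ₐ_ A (eval A g s) (eval A g t)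

Generated : (A : Alg) → Carrier A → Alg
Generated A g = record
  { Carrier = Carrier A ; _≈_ = _≈_ A
  ; U = λ x → Σ Term (λ t → _≈_ A (eval A g t) x)
  ; _∨ₐ_ = _∨ₐ_ A ; _∧ₐ_ = _∧ₐ_ A ; _·ₐ_ = _·ₐ_ A ; _⇒ₐ_ = _⇒ₐ_ A ; 𝟙 = 𝟙 A }

IsGenerator : (A : Alg) → Carrier A → Set
IsGenerator A g = U A g × (∀ y → U A y → Σ Term (λ t → _≈_ A (eval A g t) y))

ΠAlg : (Ix : Set) → (Ix → Alg) → Alg
ΠAlg Ix A = record
  { Carrier = (i : Ix) → Carrier (A i)
  ; _≈_ = λ f g → ∀ i → _≈_ (A i) (f i) (g i)
  ; U = λ f → ∀ i → U (A i) (f i)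
  ; _∨ₐ_ = λ f g i → _∨ₐ_ (A i) (f i) (g i)
  ; _∧ₐ_ = λ f g i → _∧ₐ_ (A i) (f i) (g i)
  ; _·ₐ_ = λ f g i → _·ₐ_ (A i) (f i) (g i)
  ; _⇒ₐ_ = λ f g i → _⇒ₐ_ (A i) (f i) (g i)
  ; 𝟙 = λ i → 𝟙 (A i) }

record IsEmbedding (A B : Alg) (f : Carrier A → Carrier B) : Set where
  field
    into  : ∀ x → U A x → U B (f x)
    inj   : ∀ x y → U A x → U A y → _≈_ B (f x) (f y) → _≈_ A x y
    cong  : ∀ x y → U A x → U A y → _≈_ A x y → _≈_ B (f x) (f y)
    h-∨   : ∀ x y → U A x → U A y → _≈_ B (f (_∨ₐ_ A x y)) (_∨ₐ_ B (f x) (f y))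
    h-∧   : ∀ x y → U A x → U A y → _≈_ B (f (_∧ₐ_ A x y)) (_∧ₐ_ B (f x) (f y))
    h-·   : ∀ x y → U A x → U A y → _≈_ B (f (_·ₐ_ A x y)) (_·ₐ_ B (f x) (f y))
    h-⇒   : ∀ x y → U A x → U A y → _≈_ B (f (_⇒ₐ_ A x y)) (_⇒ₐ_ B (f x) (f y))
    h-𝟙   : _≈_ B (f (𝟙 A)) (𝟙 B)

Embeddable : Alg → Alg → Set
Embeddable A B = Σ (Carrier A → Carrier B) (IsEmbedding A B)

-- Ł_n = Γ(ℤ, n)
Ł : ℕ → Alg
Ł n = record
  { Carrier = ℤ ; _≈_ = _≡_
  ; U = λ x → (+ 0 ℤ.≤ x) × (x ℤ.≤ + n)
  ; _∨ₐ_ = ℤ._⊔_ ; _∧ₐ_ = ℤ._⊓_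
  ; _·ₐ_ = λ x y → (x ℤ.+ y ℤ.- + n) ℤ.⊔ + 0
  ; _⇒ₐ_ = λ x y → (+ n ℤ.- x ℤ.+ y) ℤ.⊓ + n
  ; 𝟙 = + n }

ZZ : Set
ZZ = ℤ × ℤ

_≤ˡᵇ_ : ZZ → ZZ → Bool
(a , b) ≤ˡᵇ (c , d) = ⌊ a ℤ.<? c ⌋ ∨ (⌊ a ℤ.≟ c ⌋ ∧ (b ℤ.≤ᵇ d))

_≤ˡ_ : ZZ → ZZ → Set
x ≤ˡ y = T (x ≤ˡᵇ y)

maxˡ minˡ : ZZ → ZZ → ZZ
maxˡ x y = if x ≤ˡᵇ y then y else x
minˡ x y = if x ≤ˡᵇ y then x else y

_+ᶻ_ _-ᶻ_ : ZZ → ZZ → ZZ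
(a , b) +ᶻ (c , d) = (a ℤ.+ c , b ℤ.+ d)
(a , b) -ᶻ (c , d) = (a ℤ.- c , b ℤ.- d)

0ᶻ : ZZ
0ᶻ = (+ 0 , + 0)

-- Ł_{k,h} = Γ(ℤ ×_l ℤ, (k,h))
ŁŁ : ℕ → ℕ → Alg
ŁŁ k h = record
  { Carrier = ZZ ; _≈_ = _≡_
  ; U = λ x → (0ᶻ ≤ˡ x) × (x ≤ˡ u)
  ; _∨ₐ_ = maxˡ ; _∧ₐ_ = minˡ
  ; _·ₐ_ = λ x y → maxˡ ((x +ᶻ y) -ᶻ u) 0ᶻ
  ; _⇒ₐ_ = λ x y → minˡ ((u -ᶻ x) +ᶻ y) u
  ; 𝟙 = u }
  where u = (+ k , + h)

negᶻ : ℕ → ℕ → ZZ → ZZ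
negᶻ k h x = _⇒ₐ_ (ŁŁ k h) x 0ᶻ

Cω : Alg
Cω = record
  { Carrier = ℤ ; _≈_ = _≡_
  ; U = λ x → x ℤ.≤ + 0
  ; _∨ₐ_ = ℤ._⊔_ ; _∧ₐ_ = ℤ._⊓_
  ; _·ₐ_ = ℤ._+_
  ; _⇒ₐ_ = λ x y → + 0 ℤ.⊓ (y ℤ.- x)
  ; 𝟙 = + 0 }

-- Reduced presentations  (finite sets represented by lists)

record Presentation : Set where
  field
    I J : List ℕ
    K   : Bool          -- K = true  means  K = {ω}

open Presentation public

Reduced : Presentation → Set
Reduced P =
    (∀ m → m ∈ I P → 0 ℕ.< m)
  × (∀ n → n ∈ J P → 0 ℕ.< n)
  × ((I P ≢ []) ⊎ (J P ≢ []) ⊎ (K P ≡ true))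
  × (J P ≢ [] → K P ≡ false)
  × (∀ m n → m ∈ I P → n ∈ I P → m ≢ n → ¬ (m ∣ n))
  × (∀ m n → m ∈ I P → n ∈ J P → ¬ (m ∣ n))
  × (∀ m n → m ∈ J P → n ∈ J P → m ≢ n → ¬ (m ∣ n))

inDown : List ℕ → ℕ → Bool
inDown X k = any (λ x → ⌊ k ∣? x ⌋) X

admissible : ℕ → ℕ → Bool
admissible k h = (h <ᵇ k) ∧ (gcd k h ≡ᵇ 1)

inΔ : Presentation → ℕ → ℕ → ℕ → Bool
inΔ P k h 0 = inDown (J P) k ∧ admissible k h
inΔ P k h 1 = inDown (J P) k ∧ admissible k h
inΔ P k h 2 = inDown (I P) k ∧ admissible k h
inΔ P k h 3 = K P ∧ (k ≡ᵇ 0) ∧ (h ≡ᵇ 0)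
inΔ P k h (suc (suc (suc (suc _)))) = false

Idx : Presentation → Set
Idx P = Σ (ℕ × ℕ × ℕ) (λ { (k , h , i) → T (inΔ P k h i) })

Comp : ℕ → ℕ → ℕ → Alg
Comp k h 0 = ŁŁ k h
Comp k h 1 = ŁŁ k h
Comp k h 2 = Ł k
Comp k h (suc (suc (suc _))) = Cω

A-Δ : Presentation → Alg
A-Δ P = ΠAlg (Idx P) (λ { ((k , h , i) , _) → Comp k h i })

IsGkh : (ℕ → ℕ → ZZ) → Set
IsGkh g =
    (g 1 0 ≡ (+ 0 , + 1))
  × (∀ k h → 2 ℕ.≤ k → 0 ℕ.< h → h ℕ.< k → gcd k h ≡ 1 →
       IsGenerator (ŁŁ k h) (g k h) × (g k h ≤ˡ negᶻ k h (g k h)))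

gbarComp : (ℕ → ℕ → ZZ) → (k h i : ℕ) → Carrier (Comp k h i)
gbarComp g k h 0 = g k h
gbarComp g k h 1 = negᶻ k h (g k h)
gbarComp g k h 2 = + h
gbarComp g k h (suc (suc (suc _))) = -[1+ 0 ]

gbar : (P : Presentation) → (ℕ → ℕ → ZZ) → Carrier (A-Δ P)
gbar P g ((k , h , i) , _) = gbarComp g k h i

B-Δ : Presentation → (ℕ → ℕ → ZZ) → Alg
B-Δ P g = Generated (A-Δ P) (gbar P g)

-- Suppose a term W has, in every component A^i_{k,h} of A_Δ, a value at ḡ that is either the top,
-- or the coatom a − 1 of the component Ł_a whose generator is 1 (and that component occurs).  Then
-- m ↦ W^(a−m)(ḡ) embeds Ł_a into B_Δ: componentwise it is the constant 1 or, since
-- (a−1)^(a−m) = m in Ł_a, the identity of Ł_a.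
--
-- For a ≥ 2 and N large, W = ((¬x)^(a−1) ↔ x)^N → ¬x with ¬x = x → x^N works.  In Ł_k at
-- y < k ≤ N we have ¬y = k − y, and (¬y)^(a−1) = y iff k = a·y; otherwise the biconditional is
-- below 1, its N-th power is 0 and W = 1.  If k = a·y with gcd(k, y) = 1 then y = 1, k = a and
-- W = a − 1.  In Ł_{k,h} the first coordinate computes as in Ł_k, and there ḡ has first
-- coordinate some y < k (0 for g_{1,0}; strictly between 0 and k for g_{k,h} and ¬g_{k,h} with
-- k ≥ 2), while k = a·y would make a divide an element of J.  The components isomorphic to C_ω
-- (C_ω itself, and the elements (1, −m) of Ł_{1,0}, among them ¬g_{1,0}) give W = 1 because
-- there (¬c)^(a−1) ↔ c is a power c^d with d ≥ 1.  For a = 1 the presentation forces I = {1}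
-- and J = ∅, and W = ¬x → x works.

module Submission where

open import Data.Bool using (Bool; true; false; T; _∧_)
open import Data.Bool.Properties using (if-eta; T-∧)
open import Data.Empty using (⊥-elim)
open import Data.Integer as ℤ using (ℤ; +_; _⊖_)
import Data.Integer.Properties as ℤP
open import Data.List using (_∷_)
open import Data.List.Membership.Propositional using (_∈_; find; lose)
open import Data.List.Relation.Unary.Any using (here; there)
open import Data.List.Relation.Unary.Any.Properties using (any⁺; any⁻)
open import Data.Nat using (ℕ; zero; suc; _+_; _*_; _∸_; _≤_; _<_; _⊔_; _⊓_; z≤n; s≤s; >-nonZero)
open import Data.Nat.Divisibility using (_∣_; divides; 1∣_; ∣-refl; ∣-trans; _∣0; ∣1⇒≡1; ∣⇒≤)
open import Data.Nat.GCD using (gcd; gcd-greatest; gcd[m,n]∣m; gcd[m,n]∣n)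
open import Data.Nat.ListAction using (sum)
open import Data.Nat.Properties
open import Data.Product using (Σ; _×_; _,_; proj₁; proj₂)
open import Data.Sum using (inj₁; inj₂)
open import Data.Unit using (tt)
open import Function.Bundles using (Equivalence)
open import Relation.Binary.Definitions using (tri<; tri≈; tri>)
open import Relation.Binary.PropositionalEquality hiding (J)
open import Relation.Nullary using (¬_; yes; no)
open import Relation.Nullary.Decidable using (toWitness; fromWitness)

open import Defs

data Op : Set where
  ∨ᵒ ∧ᵒ ·ᵒ ⇒ᵒ : Op

opₐ : (A : Alg) → Op → Carrier A → Carrier A → Carrier A
opₐ A ∨ᵒ = _∨ₐ_ A
opₐ A ∧ᵒ = _∧ₐ_ A
opₐ A ·ᵒ = _·ₐ_ A
opₐ A ⇒ᵒ = _⇒ₐ_ A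

opₐ-GeneratedΠ : ∀ {Ix} (A : Ix → Alg) g o F G i →
                 opₐ (Generated (ΠAlg Ix A) g) o F G i ≡ opₐ (A i) o (F i) (G i)
opₐ-GeneratedΠ A g ∨ᵒ F G i = refl
opₐ-GeneratedΠ A g ∧ᵒ F G i = refl
opₐ-GeneratedΠ A g ·ᵒ F G i = refl
opₐ-GeneratedΠ A g ⇒ᵒ F G i = refl

eval-ΠAlg : ∀ {Ix} (A : Ix → Alg) f t i → eval (ΠAlg Ix A) f t i ≡ eval (A i) (f i) t
eval-ΠAlg A f var      i = refl
eval-ΠAlg A f one      i = refl
eval-ΠAlg A f (s ∨ᵗ t) i = cong₂ (_∨ₐ_ (A i)) (eval-ΠAlg A f s i) (eval-ΠAlg A f t i)
eval-ΠAlg A f (s ∧ᵗ t) i = cong₂ (_∧ₐ_ (A i)) (eval-ΠAlg A f s i) (eval-ΠAlg A f t i)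
eval-ΠAlg A f (s ·ᵗ t) i = cong₂ (_·ₐ_ (A i)) (eval-ΠAlg A f s i) (eval-ΠAlg A f t i)
eval-ΠAlg A f (s ⇒ᵗ t) i = cong₂ (_⇒ₐ_ (A i)) (eval-ΠAlg A f s i) (eval-ΠAlg A f t i)

≡⇒≈Comp : ∀ k h i {x y} → x ≡ y → _≈_ (Comp k h i) x y
≡⇒≈Comp k h 0                   x≡y = x≡y
≡⇒≈Comp k h 1                   x≡y = x≡y
≡⇒≈Comp k h 2                   x≡y = x≡y
≡⇒≈Comp k h (suc (suc (suc _))) x≡y = x≡y

pow : (A : Alg) → Carrier A → ℕ → Carrier A
pow A x zero    = 𝟙 A
pow A x (suc m) = _·ₐ_ A x (pow A x m)

_^ᵗ_ : Term → ℕ → Term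
t ^ᵗ zero  = one
t ^ᵗ suc m = t ·ᵗ (t ^ᵗ m)

eval-^ᵗ : ∀ A x t m → eval A x (t ^ᵗ m) ≡ pow A (eval A x t) m
eval-^ᵗ A x t zero    = refl
eval-^ᵗ A x t (suc m) = cong (_·ₐ_ A (eval A x t)) (eval-^ᵗ A x t m)

IdempotentTop : Alg → Set
IdempotentTop C = ∀ o → opₐ C o (𝟙 C) (𝟙 C) ≡ 𝟙 C

pow-𝟙 : ∀ C → IdempotentTop C → ∀ m → pow C (𝟙 C) m ≡ 𝟙 C
pow-𝟙 C idem zero    = refl
pow-𝟙 C idem (suc m) = trans (cong (_·ₐ_ C (𝟙 C)) (pow-𝟙 C idem m)) (idem ·ᵒ)

¬ᵗ : ℕ → Term
¬ᵗ N = var ⇒ᵗ (var ^ᵗ N)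

_⇔ᵗ_ : Term → Term → Term
s ⇔ᵗ t = (s ⇒ᵗ t) ∧ᵗ (t ⇒ᵗ s)

fixpointᵗ : ℕ → ℕ → Term
fixpointᵗ a N = (¬ᵗ N ^ᵗ (a ∸ 1)) ⇔ᵗ var

-- Opaque, so that unifying types which mention its value in a concrete component never
-- normalises the whole evaluation.
opaque
  separator : ℕ → ℕ → Term
  separator a N = (fixpointᵗ a N ^ᵗ N) ⇒ᵗ ¬ᵗ N

  eval-separator : ∀ A x a N →
                   eval A x (separator a N) ≡ _⇒ₐ_ A (eval A x (fixpointᵗ a N ^ᵗ N)) (eval A x (¬ᵗ N))
  eval-separator A x a N = refl

[m⊖n]⊔0≡m∸n : ∀ m n → (m ⊖ n) ℤ.⊔ + 0 ≡ + (m ∸ n)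
[m⊖n]⊔0≡m∸n m n with ≤-total n m
... | inj₁ n≤m rewrite ℤP.⊖-≥ n≤m = cong +_ (⊔-identityʳ (m ∸ n))
... | inj₂ m≤n rewrite ℤP.⊖-≤ m≤n | m≤n⇒m∸n≡0 m≤n = ℤP.i≤j⇒i⊔j≡j ℤP.neg-≤-pos

[m⊖n]⊓0≡-[n∸m] : ∀ m n → (m ⊖ n) ℤ.⊓ + 0 ≡ ℤ.- + (n ∸ m)
[m⊖n]⊓0≡-[n∸m] m n with ≤-total m n
... | inj₁ m≤n rewrite ℤP.⊖-≤ m≤n = ℤP.i≤j⇒i⊓j≡i ℤP.neg-≤-pos
... | inj₂ n≤m rewrite ℤP.⊖-≥ n≤m | m≤n⇒m∸n≡0 n≤m = cong +_ (⊓-zeroʳ (m ∸ n))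

[i+i]-i≡i : ∀ i → (i ℤ.+ i) ℤ.- i ≡ i
[i+i]-i≡i i = trans (ℤP.+-assoc i i (ℤ.- i)) (trans (cong (ℤ._+_ i) (ℤP.+-inverseʳ i)) (ℤP.+-identityʳ i))

[i-i]+i≡i : ∀ i → (i ℤ.- i) ℤ.+ i ≡ i
[i-i]+i≡i i = trans (cong (ℤ._+ i) (ℤP.+-inverseʳ i)) (ℤP.+-identityˡ i)

[i-j]+j≡i : ∀ i j → (i ℤ.- j) ℤ.+ j ≡ i
[i-j]+j≡i i j = begin
  (i ℤ.- j) ℤ.+ j     ≡⟨ ℤP.+-assoc i (ℤ.- j) j ⟩
  i ℤ.+ (ℤ.- j ℤ.+ j) ≡⟨ cong (ℤ._+_ i) (ℤP.+-inverseˡ j) ⟩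
  i ℤ.+ + 0           ≡⟨ ℤP.+-identityʳ i ⟩
  i                   ∎
  where open ≡-Reasoning

[m∸n+o]⊓m≡m∸[n∸o] : ∀ m n o → n ≤ m → (m ∸ n + o) ⊓ m ≡ m ∸ (n ∸ o)
[m∸n+o]⊓m≡m∸[n∸o] m zero o _ = trans (m≥n⇒m⊓n≡n (m≤m+n m o)) (cong (m ∸_) (sym (0∸n≡0 o)))
[m∸n+o]⊓m≡m∸[n∸o] m (suc n) zero n≤m =
  trans (cong (_⊓ m) (+-identityʳ (m ∸ suc n))) (m≤n⇒m⊓n≡m (m∸n≤m m (suc n)))
[m∸n+o]⊓m≡m∸[n∸o] (suc m) (suc n) (suc o) (s≤s n≤m) = begin
  (m ∸ n + suc o) ⊓ suc m  ≡⟨ cong (_⊓ suc m) (+-suc (m ∸ n) o) ⟩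
  suc ((m ∸ n + o) ⊓ m)    ≡⟨ cong suc ([m∸n+o]⊓m≡m∸[n∸o] m n o n≤m) ⟩
  suc (m ∸ (n ∸ o))        ≡⟨ +-∸-assoc 1 (≤-trans (m∸n≤m n o) n≤m) ⟨
  suc m ∸ (n ∸ o)          ∎
  where open ≡-Reasoning

m∸n<m : ∀ {m n} → 0 < m → 0 < n → m ∸ n < m
m∸n<m {suc m} {suc n} _ _ = s≤s (m∸n≤m m n)

0<[m∸n]⊔[n∸m] : ∀ {m n} → m ≢ n → 0 < (m ∸ n) ⊔ (n ∸ m)
0<[m∸n]⊔[n∸m] {m} {n} m≢n with <-cmp m n
... | tri< m<n _ _ = <-≤-trans (m<n⇒0<n∸m m<n) (m≤n⊔m (m ∸ n) (n ∸ m))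
... | tri≈ _ m≡n _ = ⊥-elim (m≢n m≡n)
... | tri> _ _ n<m = <-≤-trans (m<n⇒0<n∸m n<m) (m≤m⊔n (m ∸ n) (n ∸ m))

m∸[a∸1]*n≡n⇒m≡a*n : ∀ a {m n} → n < m → m ∸ (a ∸ 1) * n ≡ n → m ≡ a * n
m∸[a∸1]*n≡n⇒m≡a*n zero     n<m eq = ⊥-elim (<-irrefl (sym eq) n<m)
m∸[a∸1]*n≡n⇒m≡a*n (suc a) {m} {zero} n<m eq
  rewrite *-zeroʳ a = ⊥-elim (<-irrefl (sym eq) n<m)
m∸[a∸1]*n≡n⇒m≡a*n (suc a) {m} {suc n} _ eq = begin
  m                          ≡⟨ m∸n+n≡m a*n≤m ⟨
  m ∸ a * suc n + a * suc n  ≡⟨ cong (_+ a * suc n) eq ⟩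
  suc a * suc n              ∎
  where
  open ≡-Reasoning
  a*n≤m : a * suc n ≤ m
  a*n≤m = ≮⇒≥ (λ m<a*n → 0≢1+n (trans (sym (m≤n⇒m∸n≡0 (<⇒≤ m<a*n))) eq))

m≡a*n⇒m∸[a∸1]*n≡n : ∀ a {m n} → 1 ≤ a → m ≡ a * n → m ∸ (a ∸ 1) * n ≡ n
m≡a*n⇒m∸[a∸1]*n≡n (suc a) {n = n} _ refl = m+n∸n≡m n (a * n)

Łop : ℕ → Op → ℕ → ℕ → ℕ
Łop k ∨ᵒ x y = x ⊔ y
Łop k ∧ᵒ x y = x ⊓ y
Łop k ·ᵒ x y = x + y ∸ k
Łop k ⇒ᵒ x y = k ∸ (x ∸ y)

Ł-op : ∀ {k x} o y → x ≤ k → opₐ (Ł k) o (+ x) (+ y) ≡ + Łop k o x y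
Ł-op         ∨ᵒ y _   = refl
Ł-op         ∧ᵒ y _   = refl
Ł-op {k} {x} ·ᵒ y _   = trans (cong (ℤ._⊔ + 0) (ℤP.m-n≡m⊖n (x + y) k)) ([m⊖n]⊔0≡m∸n (x + y) k)
Ł-op {k} {x} ⇒ᵒ y x≤k = begin
  (+ k ℤ.- + x ℤ.+ + y) ℤ.⊓ + k  ≡⟨ cong (λ d → (d ℤ.+ + y) ℤ.⊓ + k) (ℤP.m-n≡m⊖n k x) ⟩
  (k ⊖ x ℤ.+ + y) ℤ.⊓ + k        ≡⟨ cong (λ d → (d ℤ.+ + y) ℤ.⊓ + k) (ℤP.⊖-≥ x≤k) ⟩
  + ((k ∸ x + y) ⊓ k)            ≡⟨ cong +_ ([m∸n+o]⊓m≡m∸[n∸o] k x y x≤k) ⟩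
  + (k ∸ (x ∸ y))                ∎
  where open ≡-Reasoning

Łop-≤ : ∀ {k x y} o → x ≤ k → y ≤ k → Łop k o x y ≤ k
Łop-≤         ∨ᵒ x≤k y≤k = ⊔-lub x≤k y≤k
Łop-≤ {y = y} ∧ᵒ x≤k _   = ≤-trans (m⊓n≤m _ y) x≤k
Łop-≤ {k} {x} ·ᵒ x≤k y≤k = begin
  x + _ ∸ k  ≤⟨ ∸-monoˡ-≤ k (+-monoʳ-≤ x y≤k) ⟩
  x + k ∸ k  ≡⟨ m+n∸n≡m x k ⟩
  x          ≤⟨ x≤k ⟩
  k          ∎
  where open ≤-Reasoning
Łop-≤ {k} {x} {y} ⇒ᵒ _ _ = m∸n≤m k (x ∸ y)

Łop-idem : ∀ k o → Łop k o k k ≡ k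
Łop-idem k ∨ᵒ = ⊔-idem k
Łop-idem k ∧ᵒ = ⊓-idem k
Łop-idem k ·ᵒ = m+n∸n≡m k k
Łop-idem k ⇒ᵒ = cong (k ∸_) (n∸n≡0 k)

Ł-idempotentTop : ∀ k → IdempotentTop (Ł k)
Ł-idempotentTop k o = trans (Ł-op o k ≤-refl) (cong +_ (Łop-idem k o))

Ł-⇔ : ∀ {k x y} → x ≤ k → y ≤ k →
      _∧ₐ_ (Ł k) (_⇒ₐ_ (Ł k) (+ x) (+ y)) (_⇒ₐ_ (Ł k) (+ y) (+ x)) ≡ + (k ∸ ((x ∸ y) ⊔ (y ∸ x)))
Ł-⇔ {k} {x} {y} x≤k y≤k =
  trans (cong₂ ℤ._⊓_ (Ł-op ⇒ᵒ y x≤k) (Ł-op ⇒ᵒ x y≤k)) (cong +_ (sym (∸-distribˡ-⊔-⊓ k (x ∸ y) (y ∸ x))))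

Ł-pow : ∀ {k c} m → c ≤ k → pow (Ł k) (+ (k ∸ c)) m ≡ + (k ∸ m * c)
Ł-pow         zero    _   = refl
Ł-pow {k} {c} (suc m) c≤k = begin
  _·ₐ_ (Ł k) (+ (k ∸ c)) (pow (Ł k) (+ (k ∸ c)) m)  ≡⟨ cong (_·ₐ_ (Ł k) (+ (k ∸ c))) (Ł-pow m c≤k) ⟩
  _·ₐ_ (Ł k) (+ (k ∸ c)) (+ (k ∸ m * c))          ≡⟨ Ł-op ·ᵒ (k ∸ m * c) (m∸n≤m k c) ⟩
  + (k ∸ c + (k ∸ m * c) ∸ k)                     ≡⟨ cong (λ n → + (k ∸ c + (k ∸ m * c) ∸ n)) (m∸n+n≡m c≤k) ⟨
  + (k ∸ c + (k ∸ m * c) ∸ (k ∸ c + c))           ≡⟨ cong +_ ([m+n]∸[m+o]≡n∸o (k ∸ c) (k ∸ m * c) c) ⟩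
  + (k ∸ m * c ∸ c)                               ≡⟨ cong +_ (∸-+-assoc k (m * c) c) ⟩
  + (k ∸ (m * c + c))                             ≡⟨ cong (λ n → + (k ∸ n)) (+-comm (m * c) c) ⟩
  + (k ∸ suc m * c)                               ∎
  where open ≡-Reasoning

Ł-pow-zero : ∀ {k x} m → x < k → k ≤ m → pow (Ł k) (+ x) m ≡ + 0
Ł-pow-zero {k} {x} m x<k k≤m = begin
  pow (Ł k) (+ x) m              ≡⟨ cong (λ y → pow (Ł k) (+ y) m) (m∸[m∸n]≡n (<⇒≤ x<k)) ⟨
  pow (Ł k) (+ (k ∸ (k ∸ x))) m  ≡⟨ Ł-pow m (m∸n≤m k x) ⟩
  + (k ∸ m * (k ∸ x))            ≡⟨ cong +_ (m≤n⇒m∸n≡0 k≤m*[k∸x]) ⟩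
  + 0                            ∎
  where
  open ≡-Reasoning
  k≤m*[k∸x] : k ≤ m * (k ∸ x)
  k≤m*[k∸x] = ≤-trans k≤m (m≤m*n m (k ∸ x) ⦃ >-nonZero (m<n⇒0<n∸m x<k) ⦄)

endpoint : ℕ → Bool → ℕ
endpoint k false = 0
endpoint k true  = k

endpoint≤ : ∀ k b → endpoint k b ≤ k
endpoint≤ k false = z≤n
endpoint≤ k true  = ≤-refl

Łop-endpoint : ∀ k o b c → Σ Bool λ e → Łop k o (endpoint k b) (endpoint k c) ≡ endpoint k e
Łop-endpoint k ∨ᵒ false false = false , refl
Łop-endpoint k ∨ᵒ false true  = true  , refl
Łop-endpoint k ∨ᵒ true  false = true  , ⊔-identityʳ k
Łop-endpoint k ∨ᵒ true  true  = true  , ⊔-idem k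
Łop-endpoint k ∧ᵒ false false = false , refl
Łop-endpoint k ∧ᵒ false true  = false , refl
Łop-endpoint k ∧ᵒ true  false = false , ⊓-zeroʳ k
Łop-endpoint k ∧ᵒ true  true  = true  , ⊓-idem k
Łop-endpoint k ·ᵒ false false = false , 0∸n≡0 k
Łop-endpoint k ·ᵒ false true  = false , n∸n≡0 k
Łop-endpoint k ·ᵒ true  false = false , trans (cong (_∸ k) (+-identityʳ k)) (n∸n≡0 k)
Łop-endpoint k ·ᵒ true  true  = true  , m+n∸n≡m k k
Łop-endpoint k ⇒ᵒ false false = true  , refl
Łop-endpoint k ⇒ᵒ false true  = true  , cong (k ∸_) (0∸n≡0 k)
Łop-endpoint k ⇒ᵒ true  false = false , n∸n≡0 k
Łop-endpoint k ⇒ᵒ true  true  = true  , cong (k ∸_) (n∸n≡0 k)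

Ł-op-endpoint : ∀ {k x y} o → Σ Bool (λ b → x ≡ + endpoint k b) → Σ Bool (λ c → y ≡ + endpoint k c) →
                Σ Bool λ e → opₐ (Ł k) o x y ≡ + endpoint k e
Ł-op-endpoint {k} o (b , refl) (c , refl) with Łop-endpoint k o b c
... | e , eq = e , trans (Ł-op o (endpoint k c) (endpoint≤ k b)) (cong +_ eq)

Ł-eval-at-0 : ∀ k t → Σ Bool λ b → eval (Ł k) (+ 0) t ≡ + endpoint k b
Ł-eval-at-0 k var      = false , refl
Ł-eval-at-0 k one      = true  , refl
Ł-eval-at-0 k (s ∨ᵗ t) = Ł-op-endpoint ∨ᵒ (Ł-eval-at-0 k s) (Ł-eval-at-0 k t)
Ł-eval-at-0 k (s ∧ᵗ t) = Ł-op-endpoint ∧ᵒ (Ł-eval-at-0 k s) (Ł-eval-at-0 k t)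
Ł-eval-at-0 k (s ·ᵗ t) = Ł-op-endpoint ·ᵒ (Ł-eval-at-0 k s) (Ł-eval-at-0 k t)
Ł-eval-at-0 k (s ⇒ᵗ t) = Ł-op-endpoint ⇒ᵒ (Ł-eval-at-0 k s) (Ł-eval-at-0 k t)

≤ˡ⇒proj₁≤ : ∀ x y → x ≤ˡ y → proj₁ x ℤ.≤ proj₁ y
≤ˡ⇒proj₁≤ (x₁ , _) (y₁ , _) x≤y with x₁ ℤ.<? y₁ | x₁ ℤ.≟ y₁
... | yes x₁<y₁ | _        = ℤP.<⇒≤ x₁<y₁
... | no _      | yes refl = ℤP.≤-refl

≰ˡ⇒proj₁≥ : ∀ x y → ¬ (x ≤ˡ y) → proj₁ y ℤ.≤ proj₁ x
≰ˡ⇒proj₁≥ (x₁ , _) (y₁ , _) x≰y with x₁ ℤ.<? y₁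
... | yes _    = ⊥-elim (x≰y tt)
... | no x₁≮y₁ = ℤP.≮⇒≥ x₁≮y₁

proj₁<⇒≤ˡ : ∀ x y → proj₁ x ℤ.< proj₁ y → x ≤ˡ y
proj₁<⇒≤ˡ (x₁ , _) (y₁ , _) x₁<y₁ with x₁ ℤ.<? y₁
... | yes _    = tt
... | no x₁≮y₁ = ⊥-elim (x₁≮y₁ x₁<y₁)

proj₁-maxˡ : ∀ x y → proj₁ (maxˡ x y) ≡ proj₁ x ℤ.⊔ proj₁ y
proj₁-maxˡ x y with x ≤ˡᵇ y in eq
... | true  = sym (ℤP.i≤j⇒i⊔j≡j (≤ˡ⇒proj₁≤ x y (subst T (sym eq) tt)))
... | false = sym (ℤP.i≥j⇒i⊔j≡i (≰ˡ⇒proj₁≥ x y (subst T eq)))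

proj₁-minˡ : ∀ x y → proj₁ (minˡ x y) ≡ proj₁ x ℤ.⊓ proj₁ y
proj₁-minˡ x y with x ≤ˡᵇ y in eq
... | true  = sym (ℤP.i≤j⇒i⊓j≡i (≤ˡ⇒proj₁≤ x y (subst T (sym eq) tt)))
... | false = sym (ℤP.i≥j⇒i⊓j≡j (≰ˡ⇒proj₁≥ x y (subst T eq)))

maxˡ-≡-left : ∀ x y → proj₁ y ℤ.< proj₁ x → maxˡ x y ≡ x
maxˡ-≡-left x y y₁<x₁ with x ≤ˡᵇ y in eq
... | true  = ⊥-elim (ℤP.<⇒≱ y₁<x₁ (≤ˡ⇒proj₁≤ x y (subst T (sym eq) tt)))
... | false = refl

minˡ-≡-right : ∀ x y → proj₁ y ℤ.< proj₁ x → minˡ x y ≡ y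
minˡ-≡-right x y y₁<x₁ with x ≤ˡᵇ y in eq
... | true  = ⊥-elim (ℤP.<⇒≱ y₁<x₁ (≤ˡ⇒proj₁≤ x y (subst T (sym eq) tt)))
... | false = refl

minˡ-same-proj₁ : ∀ c s t → minˡ (c , s) (c , t) ≡ (c , s ℤ.⊓ t)
minˡ-same-proj₁ c s t with c ℤ.<? c | c ℤ.≟ c
... | yes c<c | _        = ⊥-elim (ℤP.<-irrefl refl c<c)
... | no _    | no c≢c   = ⊥-elim (c≢c refl)
... | no _    | yes refl with s ℤ.≤ᵇ t in eq
...   | true  = cong (c ,_) (sym (ℤP.i≤j⇒i⊓j≡i (ℤP.≤ᵇ⇒≤ (subst T (sym eq) tt))))
...   | false = cong (c ,_) (sym (ℤP.i≥j⇒i⊓j≡j (ℤP.<⇒≤ (ℤP.≰⇒> (λ s≤t → subst T eq (ℤP.≤⇒≤ᵇ s≤t))))))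

proj₁-op : ∀ {k h} o x y → proj₁ (opₐ (ŁŁ k h) o x y) ≡ opₐ (Ł k) o (proj₁ x) (proj₁ y)
proj₁-op ∨ᵒ x y = proj₁-maxˡ x y
proj₁-op ∧ᵒ x y = proj₁-minˡ x y
proj₁-op ·ᵒ (x₁ , x₂) (y₁ , y₂) = proj₁-maxˡ _ 0ᶻ
proj₁-op ⇒ᵒ (x₁ , x₂) (y₁ , y₂) = proj₁-minˡ _ _

proj₁-eval : ∀ {k h} z t → proj₁ (eval (ŁŁ k h) z t) ≡ eval (Ł k) (proj₁ z) t
proj₁-eval         z var      = refl
proj₁-eval         z one      = refl
proj₁-eval {k} {h} z (s ∨ᵗ t) = trans (proj₁-op {k} {h} ∨ᵒ (eval (ŁŁ k h) z s) (eval (ŁŁ k h) z t))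
                                      (cong₂ (_∨ₐ_ (Ł k)) (proj₁-eval z s) (proj₁-eval z t))
proj₁-eval {k} {h} z (s ∧ᵗ t) = trans (proj₁-op {k} {h} ∧ᵒ (eval (ŁŁ k h) z s) (eval (ŁŁ k h) z t))
                                      (cong₂ (_∧ₐ_ (Ł k)) (proj₁-eval z s) (proj₁-eval z t))
proj₁-eval {k} {h} z (s ·ᵗ t) = trans (proj₁-op {k} {h} ·ᵒ (eval (ŁŁ k h) z s) (eval (ŁŁ k h) z t))
                                      (cong₂ (_·ₐ_ (Ł k)) (proj₁-eval z s) (proj₁-eval z t))
proj₁-eval {k} {h} z (s ⇒ᵗ t) = trans (proj₁-op {k} {h} ⇒ᵒ (eval (ŁŁ k h) z s) (eval (ŁŁ k h) z t))
                                      (cong₂ (_⇒ₐ_ (Ł k)) (proj₁-eval z s) (proj₁-eval z t))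

ŁŁ-⇒-top : ∀ {k h} x y → proj₁ x ℤ.< proj₁ y → _⇒ₐ_ (ŁŁ k h) x y ≡ (+ k , + h)
ŁŁ-⇒-top {k} (x₁ , _) (y₁ , _) x₁<y₁ =
  minˡ-≡-right _ _ (subst (ℤ._< (+ k ℤ.- x₁) ℤ.+ y₁) ([i-j]+j≡i (+ k) x₁) (ℤP.+-monoʳ-< (+ k ℤ.- x₁) x₁<y₁))

ŁŁ-idempotentTop : ∀ {k} h → 0 < k → IdempotentTop (ŁŁ k h)
ŁŁ-idempotentTop     h 0<k ∨ᵒ = if-eta _
ŁŁ-idempotentTop     h 0<k ∧ᵒ = if-eta _
ŁŁ-idempotentTop {k} h 0<k ·ᵒ =
  trans (cong (λ x → maxˡ x 0ᶻ) (cong₂ _,_ ([i+i]-i≡i (+ k)) ([i+i]-i≡i (+ h))))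
        (maxˡ-≡-left (+ k , + h) 0ᶻ (ℤ.+<+ 0<k))
ŁŁ-idempotentTop {k} h 0<k ⇒ᵒ =
  trans (cong (λ x → minˡ x (+ k , + h)) (cong₂ _,_ ([i-i]+i≡i (+ k)) ([i-i]+i≡i (+ h)))) (if-eta _)

-- The subalgebra generated by z with z₁ = 0 has first coordinates in {0, k}, which misses 1.
generator-proj₁≢0 : ∀ {k h z} → 2 ≤ k → IsGenerator (ŁŁ k h) z → proj₁ z ≢ + 0
generator-proj₁≢0 {k} {h} {z} 2≤k (_ , generates) z₁≡0
  with generates (+ 1 , + 0) (tt , proj₁<⇒≤ˡ (+ 1 , + 0) (+ k , + h) (ℤ.+<+ 2≤k))
... | t , t[z]≡[1,0] with Ł-eval-at-0 k t
...   | b , t[0]≡endpoint = endpoint≢1 b (ℤP.+-injective (trans (sym t[0]≡endpoint) t[0]≡1))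
  where
  t[0]≡1 : eval (Ł k) (+ 0) t ≡ + 1
  t[0]≡1 = trans (cong (λ x → eval (Ł k) x t) (sym z₁≡0)) (trans (sym (proj₁-eval z t)) (cong proj₁ t[z]≡[1,0]))
  endpoint≢1 : ∀ b → endpoint k b ≢ 1
  endpoint≢1 true  k≡1 = <-irrefl (sym k≡1) 2≤k
  endpoint≢1 false ()

module GeneratorProj₁ {k h z} (2≤k : 2 ≤ k) (gen : IsGenerator (ŁŁ k h) z) (z≤¬z : z ≤ˡ negᶻ k h z) where

  y : ℕ
  y = ℤ.∣ proj₁ z ∣

  proj₁-z : proj₁ z ≡ + y
  proj₁-z = sym (ℤP.0≤i⇒+∣i∣≡i (≤ˡ⇒proj₁≤ 0ᶻ z (proj₁ (proj₁ gen))))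

  y≤k : y ≤ k
  y≤k = ℤP.drop‿+≤+ (subst (ℤ._≤ + k) proj₁-z (≤ˡ⇒proj₁≤ z (+ k , + h) (proj₂ (proj₁ gen))))

  proj₁-¬z : proj₁ (negᶻ k h z) ≡ + (k ∸ y)
  proj₁-¬z = trans (proj₁-op {k} {h} ⇒ᵒ z 0ᶻ) (trans (cong (λ x → _⇒ₐ_ (Ł k) x (+ 0)) proj₁-z) (Ł-op ⇒ᵒ 0 y≤k))

  0<y : 0 < y
  0<y = n≢0⇒n>0 (λ y≡0 → generator-proj₁≢0 2≤k gen (trans proj₁-z (cong +_ y≡0)))

  y<k : y < k
  y<k = <-≤-trans (m<m+n y 0<y) (m≤o∸n⇒m+n≤o y y≤k y≤k∸y)
    where
    y≤k∸y : y ≤ k ∸ y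
    y≤k∸y = ℤP.drop‿+≤+ (subst₂ ℤ._≤_ proj₁-z proj₁-¬z (≤ˡ⇒proj₁≤ z (negᶻ k h z) z≤¬z))

  k∸y<k : k ∸ y < k
  k∸y<k = m∸n<m (<-trans 0<y y<k) 0<y

-- c^ m stands for the m-th power of the generator c.
record CωCopy (A : Alg) : Set where
  field
    c^_  : ℕ → Carrier A
    c^-· : ∀ m n → _·ₐ_ A (c^ m) (c^ n) ≡ c^ (m + n)
    c^-⇒ : ∀ m n → _⇒ₐ_ A (c^ m) (c^ n) ≡ c^ (n ∸ m)
    c^-∧ : ∀ m n → _∧ₐ_ A (c^ m) (c^ n) ≡ c^ (m ⊔ n)
    c^-0 : c^ 0 ≡ 𝟙 A

  pow-c^ : ∀ m n → pow A (c^ m) n ≡ c^ (n * m)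
  pow-c^ m zero    = sym c^-0
  pow-c^ m (suc n) = trans (cong (_·ₐ_ A (c^ m)) (pow-c^ m n)) (c^-· m (n * m))

  ¬ᵗ-c^1 : ∀ N → eval A (c^ 1) (¬ᵗ N) ≡ c^ (N ∸ 1)
  ¬ᵗ-c^1 N = trans (cong (_⇒ₐ_ A (c^ 1)) c^1^N) (c^-⇒ 1 N)
    where
    c^1^N : eval A (c^ 1) (var ^ᵗ N) ≡ c^ N
    c^1^N = trans (eval-^ᵗ A (c^ 1) var N) (trans (pow-c^ 1 N) (cong c^_ (*-identityʳ N)))

Cω-copy : CωCopy Cω
Cω-copy = record
  { c^_  = λ m → ℤ.- (+ m)
  ; c^-· = λ m n → sym (ℤP.neg-distrib-+ (+ m) (+ n))
  ; c^-⇒ = λ m n → begin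
      + 0 ℤ.⊓ (ℤ.- (+ n) ℤ.- ℤ.- (+ m))  ≡⟨ cong (λ i → + 0 ℤ.⊓ (ℤ.- (+ n) ℤ.+ i)) (ℤP.neg-involutive (+ m)) ⟩
      + 0 ℤ.⊓ (ℤ.- (+ n) ℤ.+ + m)        ≡⟨ cong (+ 0 ℤ.⊓_) (ℤP.-m+n≡n⊖m n m) ⟩
      + 0 ℤ.⊓ (m ⊖ n)                    ≡⟨ ℤP.⊓-comm (+ 0) (m ⊖ n) ⟩
      (m ⊖ n) ℤ.⊓ + 0                    ≡⟨ [m⊖n]⊓0≡-[n∸m] m n ⟩
      ℤ.- (+ (n ∸ m))                    ∎
  ; c^-∧ = λ m n → sym (ℤP.neg-distrib-⊔-⊓ (+ m) (+ n))
  ; c^-0 = refl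
  }
  where open ≡-Reasoning

-- The elements (1, −m) of Ł_{1,0}; c^ 1 is ¬g_{1,0}.
ŁŁ₁₀-copy : CωCopy (ŁŁ 1 0)
ŁŁ₁₀-copy = record
  { c^_  = λ m → + 1 , ℤ.- (+ m)
  ; c^-· = λ m n → cong (+ 1 ,_) (trans (ℤP.+-identityʳ _) (sym (ℤP.neg-distrib-+ (+ m) (+ n))))
  ; c^-⇒ = λ m n → trans (minˡ-same-proj₁ (+ 1) _ (+ 0)) (cong (+ 1 ,_) (begin
      (+ 0 ℤ.- ℤ.- (+ m) ℤ.+ ℤ.- (+ n)) ℤ.⊓ + 0
        ≡⟨ cong (λ i → (i ℤ.+ ℤ.- (+ n)) ℤ.⊓ + 0) (trans (ℤP.+-identityˡ _) (ℤP.neg-involutive (+ m))) ⟩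
      (+ m ℤ.+ ℤ.- (+ n)) ℤ.⊓ + 0  ≡⟨ cong (ℤ._⊓ + 0) (ℤP.m-n≡m⊖n m n) ⟩
      (m ⊖ n) ℤ.⊓ + 0              ≡⟨ [m⊖n]⊓0≡-[n∸m] m n ⟩
      ℤ.- (+ (n ∸ m))              ∎))
  ; c^-∧ = λ m n → trans (minˡ-same-proj₁ (+ 1) _ _) (cong (+ 1 ,_) (sym (ℤP.neg-distrib-⊔-⊓ (+ m) (+ n))))
  ; c^-0 = refl
  }
  where open ≡-Reasoning

Cω-idempotentTop : IdempotentTop Cω
Cω-idempotentTop ∨ᵒ = refl
Cω-idempotentTop ∧ᵒ = refl
Cω-idempotentTop ·ᵒ = refl
Cω-idempotentTop ⇒ᵒ = refl

module SeparatorInŁ (a N : ℕ) {k y : ℕ} (y<k : y < k) (k≤N : k ≤ N) where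

  private
    v = k ∸ (a ∸ 1) * y
    y≤k = <⇒≤ y<k

  ¬ᵗ-Ł : eval (Ł k) (+ y) (¬ᵗ N) ≡ + (k ∸ y)
  ¬ᵗ-Ł = trans (cong (_⇒ₐ_ (Ł k) (+ y)) (trans (eval-^ᵗ (Ł k) (+ y) var N) (Ł-pow-zero N y<k k≤N)))
               (Ł-op ⇒ᵒ 0 y≤k)

  fixpointᵗ-Ł : eval (Ł k) (+ y) (fixpointᵗ a N) ≡ + (k ∸ ((v ∸ y) ⊔ (y ∸ v)))
  fixpointᵗ-Ł = trans (cong (λ u → _∧ₐ_ (Ł k) (_⇒ₐ_ (Ł k) u (+ y)) (_⇒ₐ_ (Ł k) (+ y) u)) ¬y^[a∸1])
                      (Ł-⇔ (m∸n≤m k ((a ∸ 1) * y)) y≤k)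
    where
    ¬y^[a∸1] : eval (Ł k) (+ y) (¬ᵗ N ^ᵗ (a ∸ 1)) ≡ + v
    ¬y^[a∸1] = trans (eval-^ᵗ (Ł k) (+ y) (¬ᵗ N) (a ∸ 1))
                     (trans (cong (λ u → pow (Ł k) u (a ∸ 1)) ¬ᵗ-Ł) (Ł-pow (a ∸ 1) y≤k))

  fixpointᵗ^N-Ł : k ≢ a * y → eval (Ł k) (+ y) (fixpointᵗ a N ^ᵗ N) ≡ + 0
  fixpointᵗ^N-Ł k≢a*y = trans (eval-^ᵗ (Ł k) (+ y) (fixpointᵗ a N) N)
    (trans (cong (λ u → pow (Ł k) u N) fixpointᵗ-Ł)
           (Ł-pow-zero N (m∸n<m (≤-<-trans z≤n y<k) (0<[m∸n]⊔[n∸m] v≢y)) k≤N))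
    where
    v≢y : v ≢ y
    v≢y v≡y = k≢a*y (m∸[a∸1]*n≡n⇒m≡a*n a y<k v≡y)

  separator-Ł-top : k ≢ a * y → eval (Ł k) (+ y) (separator a N) ≡ + k
  separator-Ł-top k≢a*y = begin
    eval (Ł k) (+ y) (separator a N)  ≡⟨ eval-separator (Ł k) (+ y) a N ⟩
    _⇒ₐ_ (Ł k) (eval (Ł k) (+ y) (fixpointᵗ a N ^ᵗ N)) (eval (Ł k) (+ y) (¬ᵗ N))
                                      ≡⟨ cong₂ (_⇒ₐ_ (Ł k)) (fixpointᵗ^N-Ł k≢a*y) ¬ᵗ-Ł ⟩
    _⇒ₐ_ (Ł k) (+ 0) (+ (k ∸ y))      ≡⟨ Ł-op ⇒ᵒ (k ∸ y) z≤n ⟩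
    + (k ∸ (0 ∸ (k ∸ y)))             ≡⟨ cong (λ n → + (k ∸ n)) (0∸n≡0 (k ∸ y)) ⟩
    + k                               ∎
    where open ≡-Reasoning

  separator-Ł-coatom : 1 ≤ a → k ≡ a * y → eval (Ł k) (+ y) (separator a N) ≡ + (k ∸ y)
  separator-Ł-coatom 1≤a k≡a*y = begin
    eval (Ł k) (+ y) (separator a N)  ≡⟨ eval-separator (Ł k) (+ y) a N ⟩
    _⇒ₐ_ (Ł k) (eval (Ł k) (+ y) (fixpointᵗ a N ^ᵗ N)) (eval (Ł k) (+ y) (¬ᵗ N))
                                      ≡⟨ cong₂ (_⇒ₐ_ (Ł k)) fixpointᵗ^N ¬ᵗ-Ł ⟩
    _⇒ₐ_ (Ł k) (+ k) (+ (k ∸ y))      ≡⟨ Ł-op ⇒ᵒ (k ∸ y) ≤-refl ⟩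
    + (k ∸ (k ∸ (k ∸ y)))             ≡⟨ cong +_ (m∸[m∸n]≡n (m∸n≤m k y)) ⟩
    + (k ∸ y)                         ∎
    where
    open ≡-Reasoning
    v≡y : v ≡ y
    v≡y = m≡a*n⇒m∸[a∸1]*n≡n a 1≤a k≡a*y
    fixpointᵗ-top : eval (Ł k) (+ y) (fixpointᵗ a N) ≡ 𝟙 (Ł k)
    fixpointᵗ-top = trans fixpointᵗ-Ł (cong (λ d → + (k ∸ d))
      (trans (cong (λ u → (u ∸ y) ⊔ (y ∸ u)) v≡y) (cong₂ _⊔_ (n∸n≡0 y) (n∸n≡0 y))))
    fixpointᵗ^N : eval (Ł k) (+ y) (fixpointᵗ a N ^ᵗ N) ≡ + k
    fixpointᵗ^N = trans (eval-^ᵗ (Ł k) (+ y) (fixpointᵗ a N) N)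
      (trans (cong (λ u → pow (Ł k) u N) fixpointᵗ-top) (pow-𝟙 (Ł k) (Ł-idempotentTop k) N))

separator-ŁŁ-top : ∀ a N {k h y} z → proj₁ z ≡ + y → y < k → k ≤ N → k ≢ a * y →
                   eval (ŁŁ k h) z (separator a N) ≡ (+ k , + h)
separator-ŁŁ-top a N {k} {h} {y} z z₁≡y y<k k≤N k≢a*y = trans (eval-separator (ŁŁ k h) z a N)
  (ŁŁ-⇒-top (eval (ŁŁ k h) z (fixpointᵗ a N ^ᵗ N)) (eval (ŁŁ k h) z (¬ᵗ N))
    (subst₂ ℤ._<_ (sym (at-y (fixpointᵗ a N ^ᵗ N) (fixpointᵗ^N-Ł k≢a*y))) (sym (at-y (¬ᵗ N) ¬ᵗ-Ł))
            (ℤ.+<+ (m<n⇒0<n∸m y<k))))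
  where
  open SeparatorInŁ a N y<k k≤N
  at-y : ∀ t {v} → eval (Ł k) (+ y) t ≡ v → proj₁ (eval (ŁŁ k h) z t) ≡ v
  at-y t eq = trans (proj₁-eval z t) (trans (cong (λ x → eval (Ł k) x t) z₁≡y) eq)

module _ {A : Alg} (C : CωCopy A) where
  open CωCopy C

  separator-Cω-top : ∀ a N → 2 ≤ a → 3 ≤ N → eval A (c^ 1) (separator a N) ≡ 𝟙 A
  separator-Cω-top a N 2≤a 3≤N = begin
    eval A (c^ 1) (separator a N)     ≡⟨ eval-separator A (c^ 1) a N ⟩
    _⇒ₐ_ A (eval A (c^ 1) (fixpointᵗ a N ^ᵗ N)) (eval A (c^ 1) (¬ᵗ N))
                                      ≡⟨ cong₂ (_⇒ₐ_ A) fixpointᵗ^N (¬ᵗ-c^1 N) ⟩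
    _⇒ₐ_ A (c^ (N * d)) (c^ (N ∸ 1))  ≡⟨ c^-⇒ (N * d) (N ∸ 1) ⟩
    c^ (N ∸ 1 ∸ N * d)                ≡⟨ cong c^_ (m≤n⇒m∸n≡0 N∸1≤N*d) ⟩
    c^ 0                              ≡⟨ c^-0 ⟩
    𝟙 A                               ∎
    where
    open ≡-Reasoning
    V = (a ∸ 1) * (N ∸ 1)
    d = (1 ∸ V) ⊔ (V ∸ 1)
    0<d : 0 < d
    0<d = ≤-trans (∸-monoˡ-≤ 1 (*-mono-≤ (∸-monoˡ-≤ 1 2≤a) (∸-monoˡ-≤ 1 3≤N))) (m≤n⊔m (1 ∸ V) (V ∸ 1))
    N∸1≤N*d : N ∸ 1 ≤ N * d
    N∸1≤N*d = ≤-trans (m∸n≤m N 1) (m≤m*n N d ⦃ >-nonZero 0<d ⦄)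
    fixpointᵗ-c : eval A (c^ 1) (fixpointᵗ a N) ≡ c^ d
    fixpointᵗ-c = begin
      eval A (c^ 1) (fixpointᵗ a N)
        ≡⟨ cong (λ u → _∧ₐ_ A (_⇒ₐ_ A u (c^ 1)) (_⇒ₐ_ A (c^ 1) u))
                (trans (eval-^ᵗ A (c^ 1) (¬ᵗ N) (a ∸ 1))
                       (trans (cong (λ u → pow A u (a ∸ 1)) (¬ᵗ-c^1 N)) (pow-c^ (N ∸ 1) (a ∸ 1)))) ⟩
      _∧ₐ_ A (_⇒ₐ_ A (c^ V) (c^ 1)) (_⇒ₐ_ A (c^ 1) (c^ V))
        ≡⟨ cong₂ (_∧ₐ_ A) (c^-⇒ V 1) (c^-⇒ 1 V) ⟩
      _∧ₐ_ A (c^ (1 ∸ V)) (c^ (V ∸ 1))  ≡⟨ c^-∧ (1 ∸ V) (V ∸ 1) ⟩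
      c^ d                              ∎
    fixpointᵗ^N : eval A (c^ 1) (fixpointᵗ a N ^ᵗ N) ≡ c^ (N * d)
    fixpointᵗ^N = trans (eval-^ᵗ A (c^ 1) (fixpointᵗ a N) N)
                        (trans (cong (λ u → pow A u N) fixpointᵗ-c) (pow-c^ d N))

  ¬x⇒x-Cω-top : eval A (c^ 1) (¬ᵗ 2 ⇒ᵗ var) ≡ 𝟙 A
  ¬x⇒x-Cω-top = trans (cong (λ u → _⇒ₐ_ A u (c^ 1)) (¬ᵗ-c^1 2)) (trans (c^-⇒ 1 1) c^-0)

module PowerMap (a : ℕ) (1≤a : 1 ≤ a) where

  powerMap : (C : Alg) → Carrier C → ℤ → Carrier C
  powerMap C w x = pow C w (a ∸ ℤ.∣ x ∣)

  data TopOrCoatom : (C : Alg) → Carrier C → Set₁ where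
    top    : ∀ {C} → IdempotentTop C → TopOrCoatom C (𝟙 C)
    coatom : TopOrCoatom (Ł a) (+ (a ∸ 1))

  top≡ : ∀ {C w} → IdempotentTop C → w ≡ 𝟙 C → TopOrCoatom C w
  top≡ idem refl = top idem

  coatom≡ : ∀ {k w} → k ≡ a → w ≡ + (a ∸ 1) → TopOrCoatom (Ł k) w
  coatom≡ refl refl = coatom

  Ł-closed : ∀ o {x y} → U (Ł a) x → U (Ł a) y → U (Ł a) (opₐ (Ł a) o x y)
  Ł-closed o (ℤ.+≤+ {n = m} _ , ℤ.+≤+ m≤a) (ℤ.+≤+ {n = n} _ , ℤ.+≤+ n≤a)
    rewrite Ł-op o n m≤a = ℤ.+≤+ z≤n , ℤ.+≤+ (Łop-≤ o m≤a n≤a)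

  powerMap-coatom : ∀ {x} → U (Ł a) x → powerMap (Ł a) (+ (a ∸ 1)) x ≡ x
  powerMap-coatom (ℤ.+≤+ {n = m} _ , ℤ.+≤+ m≤a) = begin
    pow (Ł a) (+ (a ∸ 1)) (a ∸ m)  ≡⟨ Ł-pow (a ∸ m) 1≤a ⟩
    + (a ∸ (a ∸ m) * 1)            ≡⟨ cong (λ n → + (a ∸ n)) (*-identityʳ (a ∸ m)) ⟩
    + (a ∸ (a ∸ m))                ≡⟨ cong +_ (m∸[m∸n]≡n m≤a) ⟩
    + m                            ∎
    where open ≡-Reasoning

  powerMap-𝟙 : ∀ C w → powerMap C w (+ a) ≡ 𝟙 C
  powerMap-𝟙 C w = cong (pow C w) (n∸n≡0 a)

  powerMap-hom : ∀ {C w} → TopOrCoatom C w → ∀ o {x y} → U (Ł a) x → U (Ł a) y →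
                 powerMap C w (opₐ (Ł a) o x y) ≡ opₐ C o (powerMap C w x) (powerMap C w y)
  powerMap-hom {C} (top idem) o {x} {y} _ _ = begin
    powerMap C (𝟙 C) (opₐ (Ł a) o x y)                 ≡⟨ constant (opₐ (Ł a) o x y) ⟩
    𝟙 C                                                ≡⟨ idem o ⟨
    opₐ C o (𝟙 C) (𝟙 C)                                ≡⟨ cong₂ (opₐ C o) (constant x) (constant y) ⟨
    opₐ C o (powerMap C (𝟙 C) x) (powerMap C (𝟙 C) y)  ∎
    where
    open ≡-Reasoning
    constant : ∀ z → powerMap C (𝟙 C) z ≡ 𝟙 C
    constant z = pow-𝟙 C idem (a ∸ ℤ.∣ z ∣)
  powerMap-hom coatom o ux uy =
    trans (powerMap-coatom (Ł-closed o ux uy))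
          (sym (cong₂ (opₐ (Ł a) o) (powerMap-coatom ux) (powerMap-coatom uy)))

  Ł-embeds : (P : Presentation) (g : ℕ → ℕ → ZZ) (W : Term) →
             (∀ k h i → T (inΔ P k h i) → TopOrCoatom (Comp k h i) (eval (Comp k h i) (gbarComp g k h i) W)) →
             ∀ h₀ → T (inΔ P a h₀ 2) → eval (Ł a) (+ h₀) W ≡ + (a ∸ 1) →
             Embeddable (Ł a) (B-Δ P g)
  Ł-embeds P g W topOrCoatom h₀ j₀ W[h₀]≡coatom = f , record
    { into  = λ x _ → W ^ᵗ (a ∸ ℤ.∣ x ∣) , λ { ((k , h , i) , _) → ≡⇒≈Comp k h i refl }
    ; inj   = λ x y ux uy fx≈fy → trans (sym (f-at-j₀ ux)) (trans (fx≈fy ((a , h₀ , 2) , j₀)) (f-at-j₀ uy))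
    ; cong  = λ { x y _ _ x≡y ((k , h , i) , pf) → ≡⇒≈Comp k h i (cong (λ z → f z ((k , h , i) , pf)) x≡y) }
    ; h-∨   = f-hom ∨ᵒ
    ; h-∧   = f-hom ∧ᵒ
    ; h-·   = f-hom ·ᵒ
    ; h-⇒   = f-hom ⇒ᵒ
    ; h-𝟙   = λ { ((k , h , i) , pf) → ≡⇒≈Comp k h i (trans (f-at (+ a) k h i pf) (powerMap-𝟙 _ _)) }
    }
    where
    open ≡-Reasoning
    B = B-Δ P g

    f : ℤ → Carrier (A-Δ P)
    f x = eval (A-Δ P) (gbar P g) (W ^ᵗ (a ∸ ℤ.∣ x ∣))

    w : ∀ k h i → Carrier (Comp k h i)
    w k h i = eval (Comp k h i) (gbarComp g k h i) W

    f-at : ∀ x k h i pf → f x ((k , h , i) , pf) ≡ powerMap (Comp k h i) (w k h i) x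
    f-at x k h i pf = trans (eval-ΠAlg _ (gbar P g) (W ^ᵗ (a ∸ ℤ.∣ x ∣)) ((k , h , i) , pf))
                            (eval-^ᵗ (Comp k h i) (gbarComp g k h i) W (a ∸ ℤ.∣ x ∣))

    f-at-j₀ : ∀ {x} → U (Ł a) x → f x ((a , h₀ , 2) , j₀) ≡ x
    f-at-j₀ {x} ux = begin
      f x ((a , h₀ , 2) , j₀)       ≡⟨ f-at x a h₀ 2 j₀ ⟩
      powerMap (Ł a) (w a h₀ 2) x   ≡⟨ cong (λ v → powerMap (Ł a) v x) W[h₀]≡coatom ⟩
      powerMap (Ł a) (+ (a ∸ 1)) x  ≡⟨ powerMap-coatom ux ⟩
      x                             ∎

    f-hom : ∀ o x y → U (Ł a) x → U (Ł a) y → _≈_ B (f (opₐ (Ł a) o x y)) (opₐ B o (f x) (f y))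
    f-hom o x y ux uy ((k , h , i) , pf) = ≡⇒≈Comp k h i (begin
      f (opₐ (Ł a) o x y) j                    ≡⟨ f-at (opₐ (Ł a) o x y) k h i pf ⟩
      powerMap C (w k h i) (opₐ (Ł a) o x y)   ≡⟨ powerMap-hom (topOrCoatom k h i pf) o ux uy ⟩
      opₐ C o (powerMap C (w k h i) x) (powerMap C (w k h i) y)
                                               ≡⟨ cong₂ (opₐ C o) (f-at x k h i pf) (f-at y k h i pf) ⟨
      opₐ C o (f x j) (f y j)                  ≡⟨ opₐ-GeneratedΠ _ (gbar P g) o (f x) (f y) j ⟨
      opₐ B o (f x) (f y) j                    ∎)
      where
      j = (k , h , i) , pf
      C = Comp k h i

inDown⇒ : ∀ X k → T (inDown X k) → Σ ℕ λ n → n ∈ X × k ∣ n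
inDown⇒ X k k∈X↓ with find (any⁻ _ X k∈X↓)
... | n , n∈X , k∣n = n , n∈X , toWitness k∣n

∈⇒inDown : ∀ {X k n} → n ∈ X → k ∣ n → T (inDown X k)
∈⇒inDown n∈X k∣n = any⁺ _ (lose n∈X (fromWitness k∣n))

Δ-entry⇒ : ∀ X k h → T (inDown X k ∧ admissible k h) → (Σ ℕ λ n → n ∈ X × k ∣ n) × h < k × gcd k h ≡ 1
Δ-entry⇒ X k h pf with Equivalence.to T-∧ pf
... | k∈X↓ , adm with Equivalence.to T-∧ adm
...   | h<ᵇk , gcd≡ᵇ1 = inDown⇒ X k k∈X↓ , <ᵇ⇒< h k h<ᵇk , ≡ᵇ⇒≡ (gcd k h) 1 gcd≡ᵇ1

∈⇒≤sum : ∀ {x xs} → x ∈ xs → x ≤ sum xs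
∈⇒≤sum {xs = _ ∷ xs} (here refl)  = m≤m+n _ (sum xs)
∈⇒≤sum {xs = y ∷ _}  (there x∈xs) = ≤-trans (∈⇒≤sum x∈xs) (m≤n+m _ y)

divisor≤sum : ∀ {X k n} → (∀ m → m ∈ X → 0 < m) → n ∈ X → k ∣ n → k ≤ sum X
divisor≤sum {n = n} pos n∈X k∣n = ≤-trans (∣⇒≤ ⦃ >-nonZero (pos n n∈X) ⦄ k∣n) (∈⇒≤sum n∈X)

gcd≡1⇒0< : ∀ {k h} → 2 ≤ k → gcd k h ≡ 1 → 0 < h
gcd≡1⇒0< {h = suc _} _   _      = s≤s z≤n
gcd≡1⇒0< {k} {zero}  2≤k gcd≡1 = ⊥-elim (<-irrefl (sym (∣1⇒≡1 k∣1)) 2≤k)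
  where
  k∣1 : k ∣ 1
  k∣1 = subst (k ∣_) gcd≡1 (gcd-greatest ∣-refl (k ∣0))

module _ {P : Presentation} (red : Reduced P) where

  I∤I : ∀ {m n} → m ∈ I P → n ∈ I P → m ≢ n → ¬ (m ∣ n)
  I∤I = proj₁ (proj₂ (proj₂ (proj₂ (proj₂ red)))) _ _

  I∤J : ∀ {m n} → m ∈ I P → n ∈ J P → ¬ (m ∣ n)
  I∤J = proj₁ (proj₂ (proj₂ (proj₂ (proj₂ (proj₂ red))))) _ _

  module CaseAtLeastTwo {g : ℕ → ℕ → ZZ} (isg : IsGkh g) {a} (a∈I : a ∈ I P) (2≤a : 2 ≤ a) where

    open PowerMap a (<⇒≤ 2≤a)

    -- N bounds every k in I↓ ∪ J↓; 3 ≤ N is what the C_ω components need.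
    N : ℕ
    N = 3 + (sum (I P) + sum (J P))

    3≤N : 3 ≤ N
    3≤N = m≤m+n 3 _

    I-divisor≤N : ∀ {k n} → n ∈ I P → k ∣ n → k ≤ N
    I-divisor≤N n∈I k∣n =
      ≤-trans (divisor≤sum (proj₁ red) n∈I k∣n) (≤-trans (m≤m+n _ (sum (J P))) (m≤n+m _ 3))

    J-divisor≤N : ∀ {k n} → n ∈ J P → k ∣ n → k ≤ N
    J-divisor≤N n∈J k∣n =
      ≤-trans (divisor≤sum (proj₁ (proj₂ red)) n∈J k∣n) (≤-trans (m≤n+m _ (sum (I P))) (m≤n+m _ 3))

    W : Term
    W = separator a N

    J-component-top : ∀ {k h n y} z → n ∈ J P → k ∣ n → proj₁ z ≡ + y → y < k →
                      TopOrCoatom (ŁŁ k h) (eval (ŁŁ k h) z W)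
    J-component-top {k} {h} {n} {y} z n∈J k∣n z₁≡y y<k =
      top≡ (ŁŁ-idempotentTop h (≤-<-trans z≤n y<k))
           (separator-ŁŁ-top a N z z₁≡y y<k (J-divisor≤N n∈J k∣n) k≢a*y)
      where
      k≢a*y : k ≢ a * y
      k≢a*y k≡a*y = I∤J a∈I n∈J (∣-trans (divides y (trans k≡a*y (*-comm a y))) k∣n)

    g-generates : ∀ {k h} → 2 ≤ k → h < k → gcd k h ≡ 1 →
                  IsGenerator (ŁŁ k h) (g k h) × g k h ≤ˡ negᶻ k h (g k h)
    g-generates 2≤k h<k gcd≡1 = proj₂ isg _ _ 2≤k (gcd≡1⇒0< 2≤k gcd≡1) h<k gcd≡1

    g-topOrCoatom : ∀ {k h n} → n ∈ J P → k ∣ n → h < k → gcd k h ≡ 1 →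
                    TopOrCoatom (ŁŁ k h) (eval (ŁŁ k h) (g k h) W)
    g-topOrCoatom {1} {0} n∈J k∣n _ _ = J-component-top (g 1 0) n∈J k∣n (cong proj₁ (proj₁ isg)) (s≤s z≤n)
    g-topOrCoatom {k@(suc (suc _))} {h} n∈J k∣n h<k gcd≡1 = J-component-top (g k h) n∈J k∣n proj₁-z y<k
      where open GeneratorProj₁ (s≤s (s≤s z≤n)) (proj₁ (g-generates (s≤s (s≤s z≤n)) h<k gcd≡1))
                                                (proj₂ (g-generates (s≤s (s≤s z≤n)) h<k gcd≡1))
    g-topOrCoatom {1} {suc _} _ _ (s≤s ()) _

    ¬g-topOrCoatom : ∀ {k h n} → n ∈ J P → k ∣ n → h < k → gcd k h ≡ 1 →
                     TopOrCoatom (ŁŁ k h) (eval (ŁŁ k h) (negᶻ k h (g k h)) W)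
    ¬g-topOrCoatom {1} {0} _ _ _ _ rewrite proj₁ isg =
      top≡ (ŁŁ-idempotentTop 0 (s≤s z≤n)) (separator-Cω-top ŁŁ₁₀-copy a N 2≤a 3≤N)
    ¬g-topOrCoatom {k@(suc (suc _))} {h} n∈J k∣n h<k gcd≡1 =
      J-component-top (negᶻ k h (g k h)) n∈J k∣n proj₁-¬z k∸y<k
      where open GeneratorProj₁ (s≤s (s≤s z≤n)) (proj₁ (g-generates (s≤s (s≤s z≤n)) h<k gcd≡1))
                                                (proj₂ (g-generates (s≤s (s≤s z≤n)) h<k gcd≡1))
    ¬g-topOrCoatom {1} {suc _} _ _ (s≤s ()) _

    Ł-topOrCoatom : ∀ {k h n} → n ∈ I P → k ∣ n → h < k → gcd k h ≡ 1 →
                    TopOrCoatom (Ł k) (eval (Ł k) (+ h) W)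
    Ł-topOrCoatom {k} {h} n∈I k∣n h<k gcd≡1 with k ≟ a * h
    ... | no k≢a*y  = top≡ (Ł-idempotentTop k) (separator-Ł-top k≢a*y)
      where open SeparatorInŁ a N h<k (I-divisor≤N n∈I k∣n)
    ... | yes k≡a*h =
      coatom≡ k≡a (trans (separator-Ł-coatom (<⇒≤ 2≤a) k≡a*h) (cong₂ (λ u v → + (u ∸ v)) k≡a h≡1))
      where
      open SeparatorInŁ a N h<k (I-divisor≤N n∈I k∣n)
      h≡1 : h ≡ 1
      h≡1 = ∣1⇒≡1 (subst (h ∣_) gcd≡1 (gcd-greatest (divides a k≡a*h) ∣-refl))
      k≡a : k ≡ a
      k≡a = trans k≡a*h (trans (cong (a *_) h≡1) (*-identityʳ a))

    topOrCoatom : ∀ k h i → T (inΔ P k h i) → TopOrCoatom (Comp k h i) (eval (Comp k h i) (gbarComp g k h i) W)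
    topOrCoatom k h 0 pf with Δ-entry⇒ (J P) k h pf
    ... | (n , n∈J , k∣n) , h<k , gcd≡1 = g-topOrCoatom n∈J k∣n h<k gcd≡1
    topOrCoatom k h 1 pf with Δ-entry⇒ (J P) k h pf
    ... | (n , n∈J , k∣n) , h<k , gcd≡1 = ¬g-topOrCoatom n∈J k∣n h<k gcd≡1
    topOrCoatom k h 2 pf with Δ-entry⇒ (I P) k h pf
    ... | (n , n∈I , k∣n) , h<k , gcd≡1 = Ł-topOrCoatom n∈I k∣n h<k gcd≡1
    topOrCoatom k h 3 _ = top≡ Cω-idempotentTop (separator-Cω-top Cω-copy a N 2≤a 3≤N)

    embeds : Embeddable (Ł a) (B-Δ P g)
    embeds = Ł-embeds P g W topOrCoatom 1 a∈Δ W[1]≡coatom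
      where
      a∈Δ : T (inΔ P a 1 2)
      a∈Δ = Equivalence.from T-∧ (∈⇒inDown a∈I ∣-refl ,
              Equivalence.from T-∧ (<⇒<ᵇ 2≤a , ≡⇒≡ᵇ (gcd a 1) 1 (∣1⇒≡1 (gcd[m,n]∣n a 1))))
      W[1]≡coatom : eval (Ł a) (+ 1) W ≡ + (a ∸ 1)
      W[1]≡coatom = separator-Ł-coatom (<⇒≤ 2≤a) (sym (*-identityʳ a))
        where open SeparatorInŁ a N 2≤a (I-divisor≤N a∈I ∣-refl)

  module CaseOne {g : ℕ → ℕ → ZZ} (1∈I : 1 ∈ I P) where

    open PowerMap 1 ≤-refl

    W : Term
    W = ¬ᵗ 2 ⇒ᵗ var

    I-element≡1 : ∀ {n} → n ∈ I P → n ≡ 1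
    I-element≡1 {n} n∈I with 1 ≟ n
    ... | yes 1≡n = sym 1≡n
    ... | no 1≢n  = ⊥-elim (I∤I 1∈I n∈I 1≢n (1∣ n))

    W[0]≡0 : ∀ {k h} → k ≡ 1 → h ≡ 0 → eval (Ł k) (+ h) W ≡ + 0
    W[0]≡0 refl refl = refl

    topOrCoatom : ∀ k h i → T (inΔ P k h i) → TopOrCoatom (Comp k h i) (eval (Comp k h i) (gbarComp g k h i) W)
    topOrCoatom k h 0 pf with Δ-entry⇒ (J P) k h pf
    ... | (n , n∈J , _) , _ = ⊥-elim (I∤J 1∈I n∈J (1∣ n))
    topOrCoatom k h 1 pf with Δ-entry⇒ (J P) k h pf
    ... | (n , n∈J , _) , _ = ⊥-elim (I∤J 1∈I n∈J (1∣ n))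
    topOrCoatom k h 2 pf with Δ-entry⇒ (I P) k h pf
    ... | (n , n∈I , k∣n) , h<k , _ = coatom≡ k≡1 (W[0]≡0 k≡1 (n<1⇒n≡0 (subst (h <_) k≡1 h<k)))
      where
      k≡1 : k ≡ 1
      k≡1 = ∣1⇒≡1 (subst (k ∣_) (I-element≡1 n∈I) k∣n)
    topOrCoatom k h 3 _ = top≡ Cω-idempotentTop (¬x⇒x-Cω-top Cω-copy)

    embeds : Embeddable (Ł 1) (B-Δ P g)
    embeds = Ł-embeds P g W topOrCoatom 0 1∈Δ refl
      where
      1∈Δ : T (inΔ P 1 0 2)
      1∈Δ = Equivalence.from T-∧ (∈⇒inDown 1∈I ∣-refl ,
              Equivalence.from T-∧ (tt , ≡⇒≡ᵇ (gcd 1 0) 1 (∣1⇒≡1 (gcd[m,n]∣m 1 0))))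

theorem3p10 : (P : Presentation) → Reduced P →
    (g : ℕ → ℕ → ZZ) → IsGkh g →
    (a : ℕ) → a ∈ I P → Embeddable (Ł a) (B-Δ P g)
theorem3p10 P red g isg zero          a∈I = ⊥-elim (<-irrefl refl (proj₁ red 0 a∈I))
theorem3p10 P red g isg 1             1∈I = CaseOne.embeds red 1∈I
theorem3p10 P red g isg (suc (suc a)) a∈I = CaseAtLeastTwo.embeds red isg a∈I (s≤s (s≤s z≤n))
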